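{- Let $D$ be a finite digraph without cut vertices, and let $\mathfrak{c}$ be the number of directed cycles of $D$. Then $\kappa(D)\leq \mathfrak{c}$.
   Context: A cut vertex is a vertex whose removal increases the number of components of the underlying graph. A kernel of a digraph $D$ is a set $N\subseteq V(D)$ that is independent (no arc between two vertices of $N$) and absorbent (for every $u\in V(D)\setminus N$ there is $v\in N$ with $(u,v)\in A(D)$). Subdividing an arc $(u,v)$ means replacing it by a new vertex $a$ and the arcs $(u,a),(a,v)$. For $\Lambda\subseteq A(D)$, $D_\Lambda$ is obtained from $D$ by subdividing every arc of $\Lambda$. $\kappa(D)$ is the smallest cardinality of $\Lambda\subseteq A(D)$ such that $D_\Lambda$ has a kernel. -}

module Defs where

open import Data.Bool using (Bool; true; false; _∨_; _∧_; not; T)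
open import Data.Nat using (ℕ; zero; suc; _+_; _≤_; _<_)
open import Data.Fin using (Fin; zero; suc; toℕ; punchIn)
import Data.Fin as F
import Data.Nat as N
open import Data.List using (List; []; _∷_; _++_; [_]; length)
open import Data.List.Relation.Unary.All using (All)
open import Data.List.Relation.Unary.Unique.Propositional using (Unique)
open import Data.Product using (Σ; _×_; _,_; proj₁; proj₂)
open import Data.Sum using (_⊎_; inj₁; inj₂)
open import Data.Unit using (⊤)
open import Data.Empty using (⊥)
open import Relation.Nullary using (¬_)
open import Relation.Nullary.Decidable using (isYes)
open import Relation.Binary.PropositionalEquality using (_≡_)

-- A finite digraph on vertex set Fin n, given by its arc relation
-- (no parallel arcs; loops excluded separately by `Loopless`).
Adj : ℕ → Set
Adj n = Fin n → Fin n → Bool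

Loopless : ∀ {n} → Adj n → Set
Loopless adj = ∀ v → adj v v ≡ false

anyF : ∀ {n} → (Fin n → Bool) → Bool
anyF {zero} f = false
anyF {suc n} f = f zero ∨ anyF (λ i → f (suc i))

allF : ∀ {n} → (Fin n → Bool) → Bool
allF {zero} f = true
allF {suc n} f = f zero ∧ allF (λ i → f (suc i))

b2n : Bool → ℕ
b2n true = 1
b2n false = 0

countF : ∀ {n} → (Fin n → Bool) → ℕ
countF {zero} f = 0
countF {suc n} f = b2n (f zero) + countF (λ i → f (suc i))

und : ∀ {n} → Adj n → Fin n → Fin n → Bool
und adj x y = adj x y ∨ adj y x

reach : ∀ {n} → Adj n → ℕ → Fin n → Fin n → Bool
reach adj zero u w = isYes (u F.≟ w)
reach adj (suc k) u w = reach adj k u w ∨ anyF (λ x → reach adj k u x ∧ und adj x w)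

conn : ∀ {n} → Adj n → Fin n → Fin n → Bool
conn {n} adj u w = reach adj n u w

-- number of components = number of vertices that are the least vertex
-- of their component
ncomp : ∀ {n} → Adj n → ℕ
ncomp adj = countF (λ u → allF (λ w → not (conn adj u w) ∨ isYes (toℕ u N.≤? toℕ w)))

removeV : ∀ {m} → Adj (suc m) → Fin (suc m) → Adj m
removeV adj v i j = adj (punchIn v i) (punchIn v j)

IsCutVertex : ∀ {n} → Adj n → Fin n → Set
IsCutVertex {suc m} adj v = ncomp adj < ncomp (removeV adj v)

-- Directed cycles, each listed once: as the vertex sequence starting at
-- its least vertex (D has no parallel arcs, so this determines the cycle)

Path : ∀ {n} → Adj n → List (Fin n) → Set
Path adj [] = ⊤
Path adj (x ∷ []) = ⊤
Path adj (x ∷ y ∷ rest) = T (adj x y) × Path adj (y ∷ rest)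

IsDirCycle : ∀ {n} → Adj n → List (Fin n) → Set
IsDirCycle adj [] = ⊥
IsDirCycle adj (x ∷ xs) =
  1 ≤ length xs × Unique (x ∷ xs) × All (λ y → x F.< y) xs × Path adj (x ∷ xs ++ [ x ])

_⊆A_ : ∀ {n} → Adj n → Adj n → Set
Λ ⊆A adj = ∀ u v → T (Λ u v) → T (adj u v)

cardArcs : ∀ {n} → Adj n → ℕ
cardArcs {zero} Λ = 0
cardArcs {suc n} Λ = countF (Λ zero) + cardArcs (λ u v → Λ (suc u) (suc v)) + countF (λ u → Λ (suc u) zero)

-- vertices of D_Λ: original vertices and one new vertex per arc of Λ
SubV : ∀ {n} → Adj n → Set
SubV {n} Λ = Fin n ⊎ Σ (Fin n × Fin n) (λ p → T (Λ (proj₁ p) (proj₂ p)))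

SubArc : ∀ {n} → Adj n → (Λ : Adj n) → SubV Λ → SubV Λ → Set
SubArc adj Λ (inj₁ u) (inj₁ v) = T (adj u v) × Λ u v ≡ false
SubArc adj Λ (inj₁ u) (inj₂ ((a , b) , _)) = u ≡ a
SubArc adj Λ (inj₂ ((a , b) , _)) (inj₁ v) = v ≡ b
SubArc adj Λ (inj₂ _) (inj₂ _) = ⊥

IsKernel : (V : Set) → (V → V → Set) → (V → Bool) → Set
IsKernel V E N =
  (∀ u v → T (N u) → T (N v) → ¬ E u v)
  × (∀ u → T (not (N u)) → Σ V (λ v → T (N v) × E u v))

HasKernel : (V : Set) → (V → V → Set) → Set
HasKernel V E = Σ (V → Bool) (IsKernel V E)

-- Pick one arc on every directed cycle (its first arc) and let F be the set of
-- picked arcs, so |F| ≤ 𝔠. Then D − F is acyclic and therefore has a kernel S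
-- (repeatedly take a sink, delete it with its in-neighbours). Every arc of D
-- joining two vertices of S lies in F, since S is independent in D − F;
-- subdividing exactly these arcs makes S independent in D_Λ, while S still
-- absorbs every old vertex outside S, and each new vertex points into S.
module Submission where

open import Defs
open import Data.Bool using (Bool; true; false; _∨_; _∧_; not; T)
open import Data.Bool.Properties using (T-∧; T-∨; T-not-≡)
open import Data.Fin using (Fin; zero; suc; toℕ; _≟_) renaming (_<_ to _<ᶠ_)
import Data.Fin.Properties as FP
open import Data.List using (List; []; _∷_; _++_; [_]; length; applyUpTo; upTo)
open import Data.List.Extrema.Nat using (argmin; f[argmin]≤f[xs])
open import Data.List.Membership.Propositional using (_∈_)
open import Data.List.Membership.Propositional.Properties using (∈-upTo⁺)
open import Data.List.Properties using (applyUpTo-∷ʳ)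
open import Data.List.Relation.Unary.All as All using (All)
import Data.List.Relation.Unary.All.Properties as All
open import Data.List.Relation.Unary.Any using (here; there)
open import Data.List.Relation.Unary.Unique.Propositional using (Unique)
import Data.List.Relation.Unary.Unique.Propositional.Properties as Unique
open import Data.Nat using (ℕ; zero; suc; _+_; _*_; _≤_; _<_; z≤n; s≤s; z<s)
open import Data.Nat.DivMod using (_%_; _/_; m≡m%n+[m/n]*n; m%n<n)
open import Data.Nat.GeneralisedArithmetic using (fold; fold-+)
import Data.Nat.Properties as NP
open import Algebra.Properties.CommutativeSemigroup NP.+-commutativeSemigroup using (interchange)
open import Data.Product using (Σ; ∃₂; _×_; _,_; proj₁; proj₂)
open import Data.Sum as Sum using (_⊎_; inj₁; inj₂)
open import Data.Unit using (tt)
open import Function using (_∘_; _⇔_; mk⇔)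
open import Function.Bundles using (module Equivalence)
open import Relation.Nullary using (¬_; yes; no; ¬?; contradiction)
open import Relation.Nullary.Decidable using (isYes; T?; _×-dec_; _→-dec_; toWitness; fromWitness; toWitnessFalse; fromWitnessFalse)
open import Relation.Unary using (Decidable)
open import Relation.Binary.PropositionalEquality using (_≡_; _≢_; refl; sym; trans; cong; subst; module ≡-Reasoning)

open Equivalence using (to; from)

T-not : ∀ {b} → T (not b) ⇔ (¬ T b)
T-not {true} = mk⇔ (λ ()) (λ ¬t → ¬t tt)
T-not {false} = mk⇔ (λ _ ()) (λ _ → tt)

Minimal : (ℕ → Set) → Set
Minimal P = Σ ℕ λ p → P p × (∀ {q} → q < p → ¬ P q)

minimal : ∀ {P : ℕ → Set} → Decidable P → ∀ {k} → P k → Minimal P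
minimal P? {k} Pk with P? 0
... | yes P0 = 0 , P0 , λ ()
minimal P? {zero} P0 | no ¬P0 = contradiction P0 ¬P0
minimal P? {suc k} Pk | no ¬P0 with minimal (P? ∘ suc) Pk
... | p , Pp , below = suc p , Pp , λ { {zero} _ → ¬P0 ; {suc q} (s≤s q<p) → below q<p }

-- Counting

b2n-mono : ∀ {a b} → (T a → T b) → b2n a ≤ b2n b
b2n-mono {false} _ = z≤n
b2n-mono {true} {true} _ = s≤s z≤n
b2n-mono {true} {false} h = contradiction tt h

b2n-∨ : ∀ a b → b2n (a ∨ b) ≤ b2n a + b2n b
b2n-∨ true b = s≤s z≤n
b2n-∨ false b = NP.≤-refl

countF-mono : ∀ {n} {f g : Fin n → Bool} → (∀ i → T (f i) → T (g i)) → countF f ≤ countF g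
countF-mono {zero} h = z≤n
countF-mono {suc n} h = NP.+-mono-≤ (b2n-mono (h zero)) (countF-mono (h ∘ suc))

countF-mono-< : ∀ {n} {f g : Fin n → Bool} → (∀ i → T (f i) → T (g i)) →
                ∀ z → T (g z) → ¬ T (f z) → countF f < countF g
countF-mono-< {suc n} {f} {g} h zero gz ¬fz with f zero | g zero
... | true  | _     = contradiction tt ¬fz
... | false | false = contradiction gz (λ ())
... | false | true  = s≤s (countF-mono (h ∘ suc))
countF-mono-< {suc n} h (suc z) gz ¬fz =
  NP.+-mono-≤-< (b2n-mono (h zero)) (countF-mono-< (h ∘ suc) z gz ¬fz)

countF-∨ : ∀ {n} (f g : Fin n → Bool) → countF (λ i → f i ∨ g i) ≤ countF f + countF g
countF-∨ {zero} f g = z≤n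
countF-∨ {suc n} f g = begin
  b2n (f zero ∨ g zero) + countF (λ i → f (suc i) ∨ g (suc i))
    ≤⟨ NP.+-mono-≤ (b2n-∨ (f zero) (g zero)) (countF-∨ (f ∘ suc) (g ∘ suc)) ⟩
  (b2n (f zero) + b2n (g zero)) + (countF (f ∘ suc) + countF (g ∘ suc))
    ≡⟨ interchange (b2n (f zero)) _ _ _ ⟩
  countF f + countF g ∎
  where open NP.≤-Reasoning

countF-empty : ∀ {n} {f : Fin n → Bool} → (∀ i → ¬ T (f i)) → countF f ≤ 0
countF-empty {zero} h = z≤n
countF-empty {suc n} h = NP.+-mono-≤ (b2n-mono (h zero)) (countF-empty (h ∘ suc))

countF-single : ∀ {n} {f : Fin n → Bool} a → (∀ i → T (f i) → i ≡ a) → countF f ≤ 1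
countF-single {suc n} zero h =
  NP.+-mono-≤ (b2n-mono (λ _ → tt)) (countF-empty (λ i → FP.0≢1+n ∘ sym ∘ h (suc i)))
countF-single {suc n} (suc a) h =
  NP.+-mono-≤ (b2n-mono (FP.0≢1+n ∘ h zero)) (countF-single a (λ i → FP.suc-injective ∘ h (suc i)))

cardArcs-mono : ∀ {n} {A B : Adj n} → A ⊆A B → cardArcs A ≤ cardArcs B
cardArcs-mono {zero} h = z≤n
cardArcs-mono {suc n} h =
  NP.+-mono-≤ (NP.+-mono-≤ (countF-mono (h zero)) (cardArcs-mono (λ u v → h (suc u) (suc v))))
              (countF-mono (λ u → h (suc u) zero))

cardArcs-∨ : ∀ {n} (A B : Adj n) → cardArcs (λ u v → A u v ∨ B u v) ≤ cardArcs A + cardArcs B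
cardArcs-∨ {zero} A B = z≤n
cardArcs-∨ {suc n} A B = begin
  (countF (λ v → A zero v ∨ B zero v) + cardArcs (λ u v → A' u v ∨ B' u v))
    + countF (λ u → A (suc u) zero ∨ B (suc u) zero)
    ≤⟨ NP.+-mono-≤ (NP.+-mono-≤ (countF-∨ (A zero) (B zero)) (cardArcs-∨ A' B'))
                   (countF-∨ (λ u → A (suc u) zero) (λ u → B (suc u) zero)) ⟩
  ((a + b) + (c + d)) + (e + f)  ≡⟨ cong (_+ (e + f)) (interchange a b c d) ⟩
  ((a + c) + (b + d)) + (e + f)  ≡⟨ interchange (a + c) (b + d) e f ⟩
  cardArcs A + cardArcs B ∎
  where
  open NP.≤-Reasoning
  A' B' : Adj n
  A' u v = A (suc u) (suc v)
  B' u v = B (suc u) (suc v)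
  a = countF (A zero)
  b = countF (B zero)
  c = cardArcs A'
  d = cardArcs B'
  e = countF (λ u → A (suc u) zero)
  f = countF (λ u → B (suc u) zero)

cardArcs-empty : ∀ {n} {A : Adj n} → (∀ u v → ¬ T (A u v)) → cardArcs A ≤ 0
cardArcs-empty {zero} h = z≤n
cardArcs-empty {suc n} h =
  NP.+-mono-≤ (NP.+-mono-≤ (countF-empty (h zero)) (cardArcs-empty (λ u v → h (suc u) (suc v))))
              (countF-empty (λ u → h (suc u) zero))

cardArcs-single : ∀ {n} {A : Adj n} a b → (∀ u v → T (A u v) → u ≡ a × v ≡ b) → cardArcs A ≤ 1
cardArcs-single {suc n} zero b h =
  NP.+-mono-≤ (NP.+-mono-≤ (countF-single b (λ v → proj₂ ∘ h zero v))
                           (cardArcs-empty (λ u v → FP.0≢1+n ∘ sym ∘ proj₁ ∘ h (suc u) (suc v))))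
              (countF-empty (λ u → FP.0≢1+n ∘ sym ∘ proj₁ ∘ h (suc u) zero))
cardArcs-single {suc n} (suc a) zero h =
  NP.+-mono-≤ (NP.+-mono-≤ (countF-empty (λ v → FP.0≢1+n ∘ proj₁ ∘ h zero v))
                           (cardArcs-empty (λ u v → FP.0≢1+n ∘ sym ∘ proj₂ ∘ h (suc u) (suc v))))
              (countF-single a (λ u → FP.suc-injective ∘ proj₁ ∘ h (suc u) zero))
cardArcs-single {suc n} (suc a) (suc b) h =
  NP.+-mono-≤ (NP.+-mono-≤ (countF-empty (λ v → FP.0≢1+n ∘ proj₁ ∘ h zero v))
                           (cardArcs-single a b (λ u v t → let (p , q) = h (suc u) (suc v) t
                                                           in FP.suc-injective p , FP.suc-injective q)))
              (countF-empty (λ u → FP.0≢1+n ∘ proj₂ ∘ h (suc u) zero))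

-- Directed cycles

Arc : ∀ {n} → Adj n → Fin n → Fin n → Set
Arc E u v = T (E u v)

Acyclic : ∀ {n} → Adj n → Set
Acyclic E = ∀ c → ¬ IsDirCycle E c

Path-mono : ∀ {n} {E A : Adj n} → E ⊆A A → ∀ l → Path E l → Path A l
Path-mono h [] _ = tt
Path-mono h (x ∷ []) _ = tt
Path-mono h (x ∷ y ∷ l) (e , p) = h x y e , Path-mono h (y ∷ l) p

IsDirCycle-mono : ∀ {n} {E A : Adj n} → E ⊆A A → ∀ c → IsDirCycle E c → IsDirCycle A c
IsDirCycle-mono h (x ∷ xs) (len , uniq , least , path) = len , uniq , least , Path-mono h (x ∷ xs ++ [ x ]) path

Path-applyUpTo : ∀ {n} (E : Adj n) (f : ℕ → Fin n) → (∀ a → Arc E (f a) (f (suc a))) →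
                 ∀ k → Path E (applyUpTo f k)
Path-applyUpTo E f step zero = tt
Path-applyUpTo E f step (suc zero) = tt
Path-applyUpTo E f step (suc (suc k)) = step 0 , Path-applyUpTo E (f ∘ suc) (step ∘ suc) (suc k)

module Orbit {n} (g : Fin n → Fin n) where

  iter : ℕ → Fin n → Fin n
  iter a x = fold x g a

  iter-+ : ∀ a b x → iter (a + b) x ≡ iter a (iter b x)
  iter-+ a b x = fold-+ x g a

  eventually-periodic : ∀ x → ∃₂ λ i k → iter (suc k) (iter i x) ≡ iter i x
  eventually-periodic x with FP.pigeonhole (NP.n<1+n n) (λ j → iter (toℕ j) x)
  ... | i , j , i<j , eq with o , i+o≡j ← NP.m≤n⇒∃[o]m+o≡n i<j = toℕ i , o , (begin
    iter (suc o) (iter (toℕ i) x)  ≡⟨ iter-+ (suc o) (toℕ i) x ⟨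
    iter (suc o + toℕ i) x         ≡⟨ cong (λ a → iter a x) (trans (cong suc (NP.+-comm o (toℕ i))) i+o≡j) ⟩
    iter (toℕ j) x                 ≡⟨ eq ⟨
    iter (toℕ i) x                 ∎)
    where open ≡-Reasoning

  module _ {k y} (period : iter (suc k) y ≡ y) where

    iter-multiple : ∀ q → iter (q * suc k) y ≡ y
    iter-multiple zero = refl
    iter-multiple (suc q) = begin
      iter (suc k + q * suc k) y         ≡⟨ iter-+ (suc k) (q * suc k) y ⟩
      iter (suc k) (iter (q * suc k) y)  ≡⟨ cong (iter (suc k)) (iter-multiple q) ⟩
      iter (suc k) y                     ≡⟨ period ⟩
      y                                  ∎
      where open ≡-Reasoning

    iter-mod : ∀ c → iter c y ≡ iter (c % suc k) y
    iter-mod c = begin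
      iter c y                                         ≡⟨ cong (λ a → iter a y) (m≡m%n+[m/n]*n c (suc k)) ⟩
      iter (c % suc k + (c / suc k) * suc k) y         ≡⟨ iter-+ (c % suc k) _ y ⟩
      iter (c % suc k) (iter ((c / suc k) * suc k) y)  ≡⟨ cong (iter (c % suc k)) (iter-multiple (c / suc k)) ⟩
      iter (c % suc k) y                               ∎
      where open ≡-Reasoning

    iter-periodic : ∀ a → iter (suc k) (iter a y) ≡ iter a y
    iter-periodic a = begin
      iter (suc k) (iter a y)  ≡⟨ iter-+ (suc k) a y ⟨
      iter (suc k + a) y       ≡⟨ cong (λ b → iter b y) (NP.+-comm (suc k) a) ⟩
      iter (a + suc k) y       ≡⟨ iter-+ a (suc k) y ⟩
      iter a (iter (suc k) y)  ≡⟨ cong (iter a) period ⟩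
      iter a y                 ∎
      where open ≡-Reasoning

    -- The orbit of y is {iter a y | a ≤ k}, so a minimum over these indices is global.
    orbit-minimum : Σ ℕ λ a → ∀ c → toℕ (iter a y) ≤ toℕ (iter c y)
    orbit-minimum = a₀ , λ c →
      subst (toℕ (iter a₀ y) ≤_) (cong toℕ (sym (iter-mod c)))
            (All.lookup (f[argmin]≤f[xs] {f = cost} 0 (upTo (suc k))) (∈-upTo⁺ (m%n<n c (suc k))))
      where
      cost : ℕ → ℕ
      cost a = toℕ (iter a y)
      a₀ : ℕ
      a₀ = argmin cost 0 (upTo (suc k))

    least-period : Σ ℕ λ p → iter (suc p) y ≡ y × (∀ {a b} → a < b → b ≤ p → iter a y ≢ iter b y)
    least-period with p , return , below ← minimal (λ q → iter (suc q) y ≟ y) {k} period =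
      p , return , distinct
      where
      distinct : ∀ {a b} → a < b → b ≤ p → iter a y ≢ iter b y
      distinct {a} {b} a<b b≤p eq with e , b+e≡p ← NP.m≤n⇒∃[o]m+o≡n b≤p = below e+a<p (begin
        iter (suc e + a) y       ≡⟨ iter-+ (suc e) a y ⟩
        iter (suc e) (iter a y)  ≡⟨ cong (iter (suc e)) eq ⟩
        iter (suc e) (iter b y)  ≡⟨ iter-+ (suc e) b y ⟨
        iter (suc e + b) y       ≡⟨ cong (λ c → iter (suc c) y) (trans (NP.+-comm e b) b+e≡p) ⟩
        iter (suc p) y           ≡⟨ return ⟩
        y                        ∎)
        where
        open ≡-Reasoning
        e+a<p : e + a < p
        e+a<p = NP.<-≤-trans (NP.+-monoʳ-< e a<b) (NP.≤-reflexive (trans (NP.+-comm e b) b+e≡p))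

  module _ (E : Adj n) (loopless : Loopless E) where

    periodic-orbit-cycle : ∀ {m} p → iter (suc p) m ≡ m → (∀ {a b} → a < b → b ≤ p → iter a m ≢ iter b m) →
                           (∀ c → toℕ m ≤ toℕ (iter c m)) → (∀ a → Arc E (iter a m) (iter (suc a) m)) →
                           Σ (List (Fin n)) (IsDirCycle E)
    periodic-orbit-cycle {m} zero return _ _ step = contradiction (subst (Arc E m) return (step 0)) (subst T (loopless m))
    periodic-orbit-cycle {m} (suc q) return distinct least step =
      applyUpTo f (suc (suc q)) , s≤s z≤n , unique , above , path
      where
      f : ℕ → Fin n
      f a = iter a m
      unique : Unique (applyUpTo f (suc (suc q)))
      unique = Unique.applyUpTo⁺₁ f (suc (suc q)) (λ a<b b<p → distinct a<b (NP.≤-pred b<p))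
      above : All (m <ᶠ_) (applyUpTo (f ∘ suc) (suc q))
      above = All.applyUpTo⁺₁ (f ∘ suc) (suc q) (λ {a} a<q →
        NP.≤∧≢⇒< (least (suc a)) (λ eq → distinct z<s a<q (FP.toℕ-injective eq)))
      path : Path E (applyUpTo f (suc (suc q)) ++ [ m ])
      path = subst (λ z → Path E (applyUpTo f (suc (suc q)) ++ [ z ])) return
               (subst (Path E) (sym (applyUpTo-∷ʳ f (suc (suc q)))) (Path-applyUpTo E f step (suc (suc (suc q)))))

    orbit-cycle : ∀ x → (∀ a → Arc E (iter a x) (g (iter a x))) → Σ (List (Fin n)) (IsDirCycle E)
    orbit-cycle x along
      with i , k , period ← eventually-periodic x
      with a₀ , least ← orbit-minimum {k} {iter i x} period
      with p , return , distinct ← least-period {k} {iter a₀ (iter i x)} (iter-periodic {k} {iter i x} period a₀) =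
      periodic-orbit-cycle p return distinct least-from-m along-m
      where
      m : Fin n
      m = iter a₀ (iter i x)
      least-from-m : ∀ c → toℕ m ≤ toℕ (iter c m)
      least-from-m c = subst (λ z → toℕ m ≤ toℕ z) (iter-+ c a₀ (iter i x)) (least (c + a₀))
      along-m : ∀ a → Arc E (iter a m) (iter (suc a) m)
      along-m a = subst (λ z → Arc E z (g z)) (trans (iter-+ a (a₀ + i) x) (cong (iter a) (iter-+ a₀ i x)))
                        (along (a + (a₀ + i)))

-- Acyclic digraphs have kernels

module _ {n} (E : Adj n) (loopless : Loopless E) (acyclic : Acyclic E) where

  IsSinkIn : (Fin n → Bool) → Fin n → Set
  IsSinkIn alive z = T (alive z) × (∀ w → T (alive w) → ¬ Arc E z w)

  sink-exists : ∀ alive {x} → T (alive x) → Σ (Fin n) (IsSinkIn alive)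
  sink-exists alive {x} ax with FP.any? (λ z → T? (alive z) ×-dec FP.all? (λ w → T? (alive w) →-dec ¬? (T? (E z w))))
  ... | yes sink = sink
  ... | no noSink = contradiction (proj₂ (orbit-cycle E loopless x along)) (acyclic _)
    where
    successor : ∀ v → Σ (Fin n) λ w → T (alive v) → T (alive w) × Arc E v w
    successor v with T? (alive v)
    ... | no dead = v , λ av → contradiction av dead
    ... | yes av with FP.any? (λ w → T? (alive w) ×-dec T? (E v w))
    ...   | yes (w , aw , e) = w , λ _ → aw , e
    ...   | no none = contradiction (v , av , λ w aw e → none (w , aw , e)) noSink
    open Orbit (proj₁ ∘ successor)
    alive-along : ∀ a → T (alive (iter a x))
    alive-along zero = ax
    alive-along (suc a) = proj₁ (proj₂ (successor (iter a x)) (alive-along a))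
    along : ∀ a → Arc E (iter a x) (proj₁ (successor (iter a x)))
    along a = proj₂ (proj₂ (successor (iter a x)) (alive-along a))

  record KernelIn (alive : Fin n → Bool) : Set where
    field
      S : Fin n → Bool
      S⊆alive : ∀ u → T (S u) → T (alive u)
      independent : ∀ u v → T (S u) → T (S v) → ¬ Arc E u v
      absorbent : ∀ u → T (alive u) → ¬ T (S u) → Σ (Fin n) λ v → T (S v) × Arc E u v

  minusClosedInNbhd : (Fin n → Bool) → Fin n → Fin n → Bool
  minusClosedInNbhd alive z w = alive w ∧ (not (isYes (w ≟ z)) ∧ not (E w z))

  module _ {alive : Fin n → Bool} {z : Fin n} where

    minus-alive : ∀ {w} → T (minusClosedInNbhd alive z w) → T (alive w)
    minus-alive {w} t = proj₁ (to (T-∧ {alive w}) t)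

    minus-¬arc : ∀ {w} → T (minusClosedInNbhd alive z w) → ¬ Arc E w z
    minus-¬arc {w} t = to T-not (proj₂ (to (T-∧ {not (isYes (w ≟ z))}) (proj₂ (to (T-∧ {alive w}) t))))

    minus-¬self : ¬ T (minusClosedInNbhd alive z z)
    minus-¬self t = toWitnessFalse (proj₁ (to (T-∧ {not (isYes (z ≟ z))}) (proj₂ (to (T-∧ {alive z}) t)))) refl

    minus-intro : ∀ {w} → T (alive w) → w ≢ z → ¬ Arc E w z → T (minusClosedInNbhd alive z w)
    minus-intro aw w≢z ¬e = from T-∧ (aw , from T-∧ (fromWitnessFalse w≢z , from T-not ¬e))

    extend-by-sink : IsSinkIn alive z → KernelIn (minusClosedInNbhd alive z) → KernelIn alive
    extend-by-sink (az , sink) K = record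
      { S = S ; S⊆alive = S⊆alive ; independent = independent ; absorbent = absorbent }
      where
      module K = KernelIn K
      S : Fin n → Bool
      S u = isYes (u ≟ z) ∨ K.S u
      S-cases : ∀ {u} → T (S u) → u ≡ z ⊎ T (K.S u)
      S-cases {u} = Sum.map₁ toWitness ∘ to (T-∨ {isYes (u ≟ z)})
      z∈S : T (S z)
      z∈S = from (T-∨ {isYes (z ≟ z)}) (inj₁ (fromWitness refl))
      K⊆S : ∀ {u} → T (K.S u) → T (S u)
      K⊆S {u} = from (T-∨ {isYes (u ≟ z)}) ∘ inj₂
      S⊆alive : ∀ u → T (S u) → T (alive u)
      S⊆alive u su with S-cases su
      ... | inj₁ refl = az
      ... | inj₂ s = minus-alive (K.S⊆alive u s)
      independent : ∀ u v → T (S u) → T (S v) → ¬ Arc E u v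
      independent u v su sv e with S-cases su | S-cases sv
      ... | inj₁ refl | inj₁ refl = subst T (loopless z) e
      ... | inj₁ refl | inj₂ s = sink v (minus-alive (K.S⊆alive v s)) e
      ... | inj₂ s | inj₁ refl = minus-¬arc (K.S⊆alive u s) e
      ... | inj₂ s | inj₂ s' = K.independent u v s s' e
      absorbent : ∀ u → T (alive u) → ¬ T (S u) → Σ (Fin n) λ v → T (S v) × Arc E u v
      absorbent u au ¬su with T? (E u z)
      ... | yes e = z , z∈S , e
      ... | no ¬e with K.absorbent u (minus-intro au (λ { refl → ¬su z∈S }) ¬e) (¬su ∘ K⊆S)
      ...   | v , sv , e = v , K⊆S sv , e

  kernelIn : ∀ fuel alive → countF alive < fuel → KernelIn alive
  kernelIn (suc fuel) alive bound with FP.any? (λ x → T? (alive x))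
  ... | no empty = record
    { S = λ _ → false ; S⊆alive = λ _ () ; independent = λ _ _ () ; absorbent = λ u au _ → contradiction (u , au) empty }
  ... | yes (x , ax) with z , sz ← sink-exists alive ax =
    extend-by-sink sz (kernelIn fuel (minusClosedInNbhd alive z)
      (NP.<-≤-trans (countF-mono-< (λ _ → minus-alive {alive} {z}) z (proj₁ sz) (minus-¬self {alive} {z})) (NP.≤-pred bound)))

  acyclic⇒hasKernel : HasKernel (Fin n) (Arc E)
  acyclic⇒hasKernel = S , independent , λ u ¬su → absorbent u tt (to T-not ¬su)
    where open KernelIn (kernelIn _ (λ _ → true) (NP.n<1+n _))

-- Breaking all cycles

_∖_ : ∀ {n} → Adj n → Adj n → Adj n
(A ∖ F) u v = A u v ∧ not (F u v)

∖-⊆ : ∀ {n} (A F : Adj n) → (A ∖ F) ⊆A A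
∖-⊆ A F u v = proj₁ ∘ to T-∧

∖-loopless : ∀ {n} (A F : Adj n) → Loopless A → Loopless (A ∖ F)
∖-loopless A F loopless v = cong (_∧ not (F v v)) (loopless v)

firstArc : ∀ {n} → List (Fin n) → Adj n
firstArc [] u v = false
firstArc (x ∷ []) u v = false
firstArc (x ∷ y ∷ _) u v = isYes (u ≟ x) ∧ isYes (v ≟ y)

firstArcs : ∀ {n} → List (List (Fin n)) → Adj n
firstArcs [] u v = false
firstArcs (c ∷ cs) u v = firstArc c u v ∨ firstArcs cs u v

firstArcs-∈ : ∀ {n} {cs : List (List (Fin n))} {x y rest} → (x ∷ y ∷ rest) ∈ cs → T (firstArcs cs x y)
firstArcs-∈ {x = x} {y} {rest} (here refl) =
  from (T-∨ {firstArc (x ∷ y ∷ rest) x y}) (inj₁ (from (T-∧ {isYes (x ≟ x)}) (fromWitness refl , fromWitness refl)))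
firstArcs-∈ {cs = c ∷ _} {x} {y} (there c∈cs) = from (T-∨ {firstArc c x y}) (inj₂ (firstArcs-∈ c∈cs))

cardArcs-firstArcs : ∀ {n} (cs : List (List (Fin n))) → cardArcs (firstArcs cs) ≤ length cs
cardArcs-firstArcs {n} [] = NP.≤-trans (cardArcs-empty {A = firstArcs {n} []} (λ _ _ ())) z≤n
cardArcs-firstArcs {n} (c ∷ cs) =
  NP.≤-trans (cardArcs-∨ (firstArc c) (firstArcs cs)) (NP.+-mono-≤ (single c) (cardArcs-firstArcs cs))
  where
  single : ∀ c → cardArcs (firstArc c) ≤ 1
  single [] = NP.≤-trans (cardArcs-empty {A = firstArc {n} []} (λ _ _ ())) z≤n
  single (x ∷ []) = NP.≤-trans (cardArcs-empty {A = firstArc (x ∷ [])} (λ _ _ ())) z≤n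
  single (x ∷ y ∷ _) = cardArcs-single x y (λ u v t → let (p , q) = to (T-∧ {isYes (u ≟ x)}) t in toWitness p , toWitness q)

∖-firstArcs-acyclic : ∀ {n} (A : Adj n) (cs : List (List (Fin n))) →
                      (∀ c → IsDirCycle A c → c ∈ cs) → Acyclic (A ∖ firstArcs cs)
∖-firstArcs-acyclic A cs complete (x ∷ y ∷ rest) cycle@(_ , _ , _ , xy , _) =
  to T-not (proj₂ (to (T-∧ {A x y}) xy))
    (firstArcs-∈ (complete _ (IsDirCycle-mono (∖-⊆ A (firstArcs cs)) (x ∷ y ∷ rest) cycle)))

-- Subdividing the arcs inside a kernel

inducedArcs : ∀ {n} → Adj n → (Fin n → Bool) → Adj n
inducedArcs A S u v = S u ∧ S v ∧ A u v

inducedArcs-⊆ : ∀ {n} (A : Adj n) S → inducedArcs A S ⊆A A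
inducedArcs-⊆ A S u v t = proj₂ (to (T-∧ {S v}) (proj₂ (to (T-∧ {S u}) t)))

inducedArcs-⊆-removed : ∀ {n} (A F : Adj n) S → (∀ u v → T (S u) → T (S v) → ¬ Arc (A ∖ F) u v) →
                        inducedArcs A S ⊆A F
inducedArcs-⊆-removed A F S independent u v t with T? (F u v)
... | yes f = f
... | no ¬f with su , svA ← to (T-∧ {S u}) t with sv , a ← to (T-∧ {S v}) svA =
  contradiction (from T-∧ (a , from T-not ¬f)) (independent u v su sv)

subdivision-hasKernel : ∀ {n} {E A : Adj n} → E ⊆A A → (S : Fin n → Bool) → IsKernel (Fin n) (Arc E) S →
                        HasKernel (SubV (inducedArcs A S)) (SubArc A (inducedArcs A S))
subdivision-hasKernel {A = A} E⊆A S (independent , absorbent) = N , N-independent , N-absorbent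
  where
  Λ = inducedArcs A S
  N : SubV Λ → Bool
  N (inj₁ u) = S u
  N (inj₂ _) = false
  N-independent : ∀ x y → T (N x) → T (N y) → ¬ SubArc A Λ x y
  N-independent (inj₁ u) (inj₁ v) su sv (a , unsubdivided) =
    subst T unsubdivided (from (T-∧ {S u}) (su , from (T-∧ {S v}) (sv , a)))
  N-absorbent : ∀ x → T (not (N x)) → Σ (SubV Λ) λ y → T (N y) × SubArc A Λ x y
  N-absorbent (inj₁ u) ¬su with v , sv , e ← absorbent u ¬su =
    inj₁ v , sv , E⊆A u v e , cong (_∧ (S v ∧ A u v)) (to T-not-≡ ¬su)
  N-absorbent (inj₂ ((a , b) , ab∈Λ)) _ = inj₁ b , proj₁ (to (T-∧ {S b}) (proj₂ (to (T-∧ {S a}) ab∈Λ))) , refl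

mainTheorem3 : ∀ {n} (adj : Adj n) → Loopless adj
    → (∀ v → ¬ IsCutVertex adj v)
    → (cycles : List (List (Fin n))) → Unique cycles
    → (∀ c → (IsDirCycle adj c → c ∈ cycles) × (c ∈ cycles → IsDirCycle adj c))
    → Σ (Adj n) (λ Λ → (Λ ⊆A adj) × (cardArcs Λ ≤ length cycles) × HasKernel (SubV Λ) (SubArc adj Λ))
mainTheorem3 adj loopless _ cycles _ cycles-exact =
  inducedArcs adj S , inducedArcs-⊆ adj S , card , subdivision-hasKernel (∖-⊆ adj F) S S-kernel
  where
  F = firstArcs cycles
  kernel : HasKernel (Fin _) (Arc (adj ∖ F))
  kernel = acyclic⇒hasKernel (adj ∖ F) (∖-loopless adj F loopless) (∖-firstArcs-acyclic adj cycles (proj₁ ∘ cycles-exact))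
  S = proj₁ kernel
  S-kernel = proj₂ kernel
  card : cardArcs (inducedArcs adj S) ≤ length cycles
  card = NP.≤-trans (cardArcs-mono (inducedArcs-⊆-removed adj F S (proj₁ S-kernel))) (cardArcs-firstArcs cycles)
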